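{- Let $n\ge 4$ and let $F$ be a subgraph of the convex complete graph $K_n$ that has configuration $\mathcal{F}_n(*)$. Then $K_n - F$ admits no triangulation.
   Context: A convex complete graph $K_m$ is the complete graph on $m$ points in convex position in the plane, edges drawn as straight-line segments. Boundary edges are edges joining vertices consecutive along the convex hull boundary. Two edges with four distinct endpoints cross if the segments intersect, i.e. their endpoints alternate along the boundary. $K_m-F$ denotes the convex graph obtained from $K_m$ by deleting the edges of the subgraph $F$ (all $m$ vertices kept). A convex graph $G$ on $m$ vertices admits a triangulation if it contains a maximal plane straight-line subdivision on vertex set $V(G)$, i.e. $G$ contains all $m$ boundary edges and $m-3$ pairwise non-crossing diagonals. $d_F(v)$ is the degree of $v$ in $F$; a pendant vertex of $F$ is one of degree $1$ in $F$. Configuration $\mathcal{F}_m(*)$: a subgraph $F$ of $K_m$ has this configuration if $F$ has exactly $m-2$ edges, has no isolated vertices (every vertex of $K_m$ meets an edge of $F$), and for some labelling $v_0,\dots,v_{m-1}$ of the vertices of $K_m$ in cyclic order along the boundary (subscripts mod $m$), either (a) $E(F)=\{v_0v_i: i=2,\dots,m-2\}\cup\{v_1v_{m-1}\}$, or (b) there is an integer $k$ with $2\le k\le m-4$ such that: (i) for $i=0,1,\dots,k-1$, $d_F(v_i)\ge 2$ and $v_{i-1}v_{i+1}\in E(F)$; (ii) for $i=k,k+1,\dots,m-1$, $d_F(v_i)=1$ and $v_i$ is adjacent in $F$ to a non-pendant vertex of $F$; (iii) whenever $u,v$ are pendant vertices of $F$ such that the edges $uv_i$ and $vv_j$ of $F$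 cross, then $|i-j|=1$. -}

module Defs where

open import Data.Nat using (ℕ; zero; suc; _+_; _∸_; _≤_; _<_; _<ᵇ_; NonZero)
open import Data.Nat.DivMod using (_mod_; _%_)
open import Data.Bool using (Bool; true; false; if_then_else_; _∧_)
open import Data.Fin using (Fin; toℕ)
open import Data.List using (List; []; _∷_; length; map; concatMap; allFin)
open import Data.Nat.ListAction using (sum)
open import Data.List.Relation.Unary.All using (All)
open import Data.List.Relation.Unary.AllPairs using (AllPairs)
open import Data.List.Relation.Unary.Unique.Propositional using (Unique)
open import Data.Product using (Σ; _×_; ∃; ∃-syntax)
open import Data.Sum using (_⊎_)
open import Relation.Binary.PropositionalEquality using (_≡_; _≢_)
open import Relation.Nullary using (¬_)
open import Function.Bundles using (_⇔_)

-- Vertices of the convex K_n are Fin n, numbered 0,…,n-1 in cyclic order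
-- along the convex hull boundary.

record SimpleGraph (n : ℕ) : Set where
  field
    adj   : Fin n → Fin n → Bool
    sym   : ∀ x y → adj x y ≡ adj y x
    irrefl : ∀ x → adj x x ≡ false
open SimpleGraph public

Edge : ∀ {n} → SimpleGraph n → Fin n → Fin n → Set
Edge F x y = adj F x y ≡ true

b2n : Bool → ℕ
b2n true = 1
b2n false = 0

deg : ∀ {n} → SimpleGraph n → Fin n → ℕ
deg {n} F v = sum (map (λ u → b2n (adj F v u)) (allFin n))

edgeCount : ∀ {n} → SimpleGraph n → ℕ
edgeCount {n} F =
  sum (concatMap (λ x → map (λ y → b2n ((toℕ x <ᵇ toℕ y) ∧ adj F x y)) (allFin n)) (allFin n))

SamePair : ∀ {n} → Fin n → Fin n → Fin n → Fin n → Set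
SamePair x y a b = (x ≡ a × y ≡ b) ⊎ (x ≡ b × y ≡ a)

-- boundary edges: consecutive vertices along the hull (cyclically)
next : ∀ {n} .{{_ : NonZero n}} → Fin n → Fin n
next {n} x = suc (toℕ x) mod n

IsBoundary : ∀ {n} .{{_ : NonZero n}} → Fin n → Fin n → Set
IsBoundary x y = (y ≡ next x) ⊎ (x ≡ next y)

Between : ∀ {n} → Fin n → Fin n → Fin n → Set
Between x a b = (toℕ a < toℕ x × toℕ x < toℕ b) ⊎ (toℕ b < toℕ x × toℕ x < toℕ a)

Distinct4 : ∀ {n} → Fin n → Fin n → Fin n → Fin n → Set
Distinct4 a b c d = a ≢ b × a ≢ c × a ≢ d × b ≢ c × b ≢ d × c ≢ d

-- segments ab and cd cross: four distinct endpoints alternating along the boundary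
Cross : ∀ {n} → Fin n → Fin n → Fin n → Fin n → Set
Cross a b c d = Distinct4 a b c d ×
  ((Between c a b × ¬ Between d a b) ⊎ (¬ Between c a b × Between d a b))

-- a labelling v_0,…,v_{n-1} of the vertices in cyclic order along the boundary,
-- starting at s, in either orientation; subscripts taken mod n.
Labelling : ∀ {n} .{{_ : NonZero n}} → Fin n → Bool → ℕ → Fin n
Labelling {n} s true  k = (toℕ s + k) mod n
Labelling {n} s false k = (toℕ s + (n ∸ (k % n))) mod n

module _ {n : ℕ} .{{_ : NonZero n}} (F : SimpleGraph n) (v : ℕ → Fin n) where

  Pendant : Fin n → Set
  Pendant u = deg F u ≡ 1

  CaseA : Set
  CaseA = ∀ x y → Edge F x y ⇔
    ((∃[ i ] (2 ≤ i × i ≤ n ∸ 2 × SamePair x y (v 0) (v i)))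
     ⊎ SamePair x y (v 1) (v (n ∸ 1)))

  CaseB : ℕ → Set
  CaseB k =
    2 ≤ k × k ≤ n ∸ 4 ×
    (∀ i → i < k → 2 ≤ deg F (v i) × Edge F (v (i + (n ∸ 1))) (v (i + 1))) ×
    (∀ i → k ≤ i → i ≤ n ∸ 1 →
       Pendant (v i) × ∃[ u ] (Edge F (v i) u × ¬ Pendant u)) ×
    (∀ (u w : Fin n) (i j : ℕ) → i < n → j < n →
       Pendant u → Pendant w → Edge F u (v i) → Edge F w (v j) →
       Cross u (v i) w (v j) → (j ≡ suc i ⊎ i ≡ suc j))

ConfigStar : ∀ {n} .{{_ : NonZero n}} → SimpleGraph n → Set
ConfigStar {n} F =
  edgeCount F ≡ n ∸ 2 ×
  (∀ x → ∃[ y ] Edge F x y) ×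
  ∃[ s ] ∃[ o ] (CaseA F (Labelling s o) ⊎ ∃[ k ] CaseB F (Labelling s o) k)

IsDiagonal : ∀ {n} .{{_ : NonZero n}} → SimpleGraph n → Σ (Fin n) (λ _ → Fin n) → Set
IsDiagonal F (x Data.Product., y) = toℕ x < toℕ y × ¬ IsBoundary x y × adj F x y ≡ false

NonCrossing : ∀ {n} → Σ (Fin n) (λ _ → Fin n) → Σ (Fin n) (λ _ → Fin n) → Set
NonCrossing (a Data.Product., b) (c Data.Product., d) = ¬ Cross a b c d

ComplementAdmitsTriangulation : ∀ {n} .{{_ : NonZero n}} → SimpleGraph n → Set
ComplementAdmitsTriangulation {n} F =
  (∀ x y → IsBoundary x y → adj F x y ≡ false) ×
  ∃[ D ] (length D ≡ n ∸ 3 × Unique D × All (IsDiagonal F) D × AllPairs NonCrossing D)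

module Submission where

-- Let D be n - 3 pairwise non-crossing diagonals of K_n - F.  Read through
-- the labelling v of the configuration (a rotation, possibly composed with a
-- reflection, of the convex n-gon, hence crossing-preserving), D becomes a
-- family of non-interleaving chords of the polygon 0, 1, …, n-1.  A counting
-- argument shows that n - 3 such chords triangulate the polygon recursively:
-- each sub-polygon is cut by the triangle on its base whose apex is the
-- farthest chord-neighbour of its first vertex.  In case (a) the triangle on
-- the edge v_0 v_{n-1} has a side in F.  In case (b), reading from v_k on,
-- induction over these triangles (PendantFan) shows each one either contains
-- an ear v_t v_{t+2} in F, closes a short edge of F at a pendant vertex, or
-- leaves a smaller polygon of the same kind, which is impossible.

open import Defs
open import Data.Nat
  using (ℕ; zero; suc; _+_; _∸_; _≤_; _<_; _<ᵇ_; NonZero; z≤n; s≤s; s≤s⁻¹; pred; _≟_; _≤?_; _<?_)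
open import Data.Nat.Properties
open import Data.Nat.DivMod
  using (_%_; _mod_; %-distribˡ-+; m%n%n≡m%n; m<n⇒m%n≡m; n%n≡0; m%n<n; [m+n]%n≡m%n)
open import Data.Bool using (Bool; true; false; _∧_; _∨_; not)
open import Data.Bool.Properties using (not-¬)
open import Data.Product using (_×_; _,_; proj₁; proj₂; ∃; ∃-syntax)
open import Data.Sum using (_⊎_; inj₁; inj₂)
open import Data.Product.Properties using (≡-dec)
open import Data.Empty using (⊥; ⊥-elim)
open import Data.Fin using (Fin; toℕ)
import Data.Fin.Properties as Fin
open import Data.Fin.Base using (punchOut)
open import Relation.Binary.PropositionalEquality
  using (_≡_; _≢_; refl; trans; cong; cong₂; subst; subst₂; module ≡-Reasoning) renaming (sym to ≡-sym)
open import Data.List using (List; []; _∷_; length; map; tabulate)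
open import Data.List.Properties using (map-tabulate; length-map)
open import Data.Nat.ListAction using (sum)
open import Data.List.Relation.Unary.All using (All; []; _∷_)
import Data.List.Relation.Unary.All as All
import Data.List.Relation.Unary.All.Properties as All
open import Data.List.Relation.Unary.Any using (here; there)
open import Data.List.Relation.Unary.AllPairs using (AllPairs; []; _∷_)
open import Data.List.Relation.Unary.Unique.Propositional using (Unique)
open import Data.List.Membership.Propositional using (_∈_)
open import Data.List.Membership.Propositional.Properties using (∈-map⁻)
open import Data.Nat.Tactic.RingSolver using (solve-∀)
open import Relation.Nullary using (¬_; yes; no; Dec)
open import Relation.Nullary.Decidable using (_×-dec_; _⊎-dec_; ¬?)
open import Relation.Binary using (tri<; tri≈; tri>)
open import Function.Bundles using (Equivalence)

majority : Bool → Bool → Bool → Bool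
majority a b c = (a ∧ b) ∨ ((b ∧ c) ∨ (c ∧ a))

majority-rotate : ∀ a b c → majority a b c ≡ majority b c a
majority-rotate true  true  true  = refl
majority-rotate true  true  false = refl
majority-rotate true  false true  = refl
majority-rotate true  false false = refl
majority-rotate false true  true  = refl
majority-rotate false true  false = refl
majority-rotate false false true  = refl
majority-rotate false false false = refl

majority-swap : ∀ a b c → majority a b c ≡ majority b a c
majority-swap true  true  true  = refl
majority-swap true  true  false = refl
majority-swap true  false true  = refl
majority-swap true  false false = refl
majority-swap false true  true  = refl
majority-swap false true  false = refl
majority-swap false false true  = refl
majority-swap false false false = refl

majority-not : ∀ a b c → majority (not a) (not b) (not c) ≡ not (majority a b c)
majority-not true  true  true  = refl
majority-not true  true  false = refl
majority-not true  false true  = refl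
majority-not true  false false = refl
majority-not false true  true  = refl
majority-not false true  false = refl
majority-not false false true  = refl
majority-not false false false = refl

majority-tf : ∀ c → majority true false c ≡ c
majority-tf true  = refl
majority-tf false = refl

majority-ft : ∀ c → majority false true c ≡ c
majority-ft true  = refl
majority-ft false = refl

majority-swap₂₃ : ∀ c → majority c false true ≡ majority c true false
majority-swap₂₃ true  = refl
majority-swap₂₃ false = refl

<ᵇ-true : ∀ {m n} → m < n → (m <ᵇ n) ≡ true
<ᵇ-true {zero}  {suc n} _       = refl
<ᵇ-true {suc m} {suc n} (s≤s p) = <ᵇ-true p

<ᵇ-false : ∀ {m n} → n ≤ m → (m <ᵇ n) ≡ false
<ᵇ-false {m}     {zero}  _       = refl
<ᵇ-false {suc m} {suc n} (s≤s p) = <ᵇ-false p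

<ᵇ-flip : ∀ {m n} → m ≢ n → (n <ᵇ m) ≡ not (m <ᵇ n)
<ᵇ-flip {m} {n} m≢n with <-cmp m n
... | tri< m<n _ _ = trans (<ᵇ-false (<⇒≤ m<n)) (cong not (≡-sym (<ᵇ-true m<n)))
... | tri≈ _ m≡n _ = ⊥-elim (m≢n m≡n)
... | tri> _ _ n<m = trans (<ᵇ-true n<m) (cong not (≡-sym (<ᵇ-false (<⇒≤ n<m))))

-- cyclic x y z: the points x, y, z are met in this order when going once
-- around the cycle 0 → 1 → ⋯ → n-1 → 0 (for any n bounding them), i.e.
-- at least two of x < y, y < z, z < x hold.
cyclic : ℕ → ℕ → ℕ → Bool
cyclic x y z = majority (x <ᵇ y) (y <ᵇ z) (z <ᵇ x)

cyclic-rotate : ∀ x y z → cyclic x y z ≡ cyclic y z x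
cyclic-rotate x y z = majority-rotate (x <ᵇ y) (y <ᵇ z) (z <ᵇ x)

cyclic-reverse : ∀ {x y z} → x ≢ y → y ≢ z → z ≢ x → cyclic z y x ≡ not (cyclic x y z)
cyclic-reverse {x} {y} {z} x≢y y≢z z≢x = begin
  majority (z <ᵇ y) (y <ᵇ x) (x <ᵇ z)
    ≡⟨ cong₃ majority (<ᵇ-flip y≢z) (<ᵇ-flip x≢y) (<ᵇ-flip z≢x) ⟩
  majority (not (y <ᵇ z)) (not (x <ᵇ y)) (not (z <ᵇ x))
    ≡⟨ majority-swap (not (y <ᵇ z)) (not (x <ᵇ y)) _ ⟩
  majority (not (x <ᵇ y)) (not (y <ᵇ z)) (not (z <ᵇ x))
    ≡⟨ majority-not (x <ᵇ y) (y <ᵇ z) (z <ᵇ x) ⟩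
  not (cyclic x y z) ∎
  where
  open ≡-Reasoning
  cong₃ : ∀ (f : Bool → Bool → Bool → Bool) {a a′ b b′ c c′} →
          a ≡ a′ → b ≡ b′ → c ≡ c′ → f a b c ≡ f a′ b′ c′
  cong₃ f refl refl refl = refl

cyclic-ordered : ∀ {x y z} → x < y → y < z → cyclic x y z ≡ true
cyclic-ordered x<y y<z rewrite <ᵇ-true x<y | <ᵇ-true y<z = refl

cyclic-misordered : ∀ {x y z} → x < y → y < z → cyclic x z y ≡ false
cyclic-misordered {x} {y} {z} x<y y<z
  rewrite <ᵇ-true (<-trans x<y y<z) | <ᵇ-false (<⇒≤ y<z) | <ᵇ-false (<⇒≤ x<y) = refl

Betweenℕ : ℕ → ℕ → ℕ → Set
Betweenℕ x a b = (a < x × x < b) ⊎ (b < x × x < a)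

Distinct4ℕ : ℕ → ℕ → ℕ → ℕ → Set
Distinct4ℕ a b c d = a ≢ b × a ≢ c × a ≢ d × b ≢ c × b ≢ d × c ≢ d

-- The chord ab separates c from d: c and d lie on different sides of ab.
-- Stated via orientation so that it is visibly invariant under rotations.
Crosses : ℕ → ℕ → ℕ → ℕ → Set
Crosses a b c d = Distinct4ℕ a b c d × cyclic a c b ≡ not (cyclic a d b)

OppositeSides : ∀ {n} → Fin n → Fin n → Fin n → Fin n → Set
OppositeSides c d a b = (Between c a b × ¬ Between d a b) ⊎ (¬ Between c a b × Between d a b)

cyclic-side : ∀ {a b c} → a ≢ c → c ≢ b → b ≢ a →
  (Betweenℕ c a b × cyclic a c b ≡ (a <ᵇ b)) ⊎ (¬ Betweenℕ c a b × cyclic a c b ≡ not (a <ᵇ b))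
cyclic-side {a} {b} {c} a≢c c≢b b≢a with <-cmp a c | <-cmp c b
... | tri≈ _ a≡c _ | _ = ⊥-elim (a≢c a≡c)
... | _ | tri≈ _ c≡b _ = ⊥-elim (c≢b c≡b)
... | tri< a<c _ _ | tri< c<b _ _ =
  inj₁ (inj₁ (a<c , c<b) , trans (cyclic-ordered a<c c<b) (≡-sym (<ᵇ-true (<-trans a<c c<b))))
... | tri> _ _ c<a | tri> _ _ b<c =
  inj₁ (inj₂ (b<c , c<a) , trans (cyclic-ordered-backwards b<c c<a) (≡-sym (<ᵇ-false (<⇒≤ (<-trans b<c c<a)))))
  where
  cyclic-ordered-backwards : ∀ {x y z} → x < y → y < z → cyclic z y x ≡ false
  cyclic-ordered-backwards x<y y<z
    rewrite <ᵇ-false (<⇒≤ y<z) | <ᵇ-false (<⇒≤ x<y) | <ᵇ-true (<-trans x<y y<z) = refl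
... | tri< a<c _ _ | tri> _ _ b<c =
  inj₂ ( (λ { (inj₁ (_ , c<b)) → <-asym c<b b<c ; (inj₂ (_ , c<a)) → <-asym a<c c<a })
       , trans (side a<c b<c) (<ᵇ-flip (λ a≡b → b≢a (≡-sym a≡b))))
  where
  side : a < c → b < c → cyclic a c b ≡ (b <ᵇ a)
  side a<c b<c rewrite <ᵇ-true a<c | <ᵇ-false (<⇒≤ b<c) = majority-tf (b <ᵇ a)
... | tri> _ _ c<a | tri< c<b _ _ =
  inj₂ ( (λ { (inj₁ (a<c , _)) → <-asym a<c c<a ; (inj₂ (b<c , _)) → <-asym c<b b<c })
       , trans (side c<a c<b) (<ᵇ-flip (λ a≡b → b≢a (≡-sym a≡b))))
  where
  side : c < a → c < b → cyclic a c b ≡ (b <ᵇ a)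
  side c<a c<b rewrite <ᵇ-false (<⇒≤ c<a) | <ᵇ-true c<b = majority-ft (b <ᵇ a)

crosses⇒Cross : ∀ {n} (a b c d : Fin n) → Crosses (toℕ a) (toℕ b) (toℕ c) (toℕ d) → Cross a b c d
crosses⇒Cross a b c d ((a≢b , a≢c , a≢d , b≢c , b≢d , c≢d) , separated) =
  (≢-toℕ a≢b , ≢-toℕ a≢c , ≢-toℕ a≢d , ≢-toℕ b≢c , ≢-toℕ b≢d , ≢-toℕ c≢d) , sides
  where
  ≢-toℕ : ∀ {n} {x y : Fin n} → toℕ x ≢ toℕ y → x ≢ y
  ≢-toℕ p x≡y = p (cong toℕ x≡y)
  b≢a : toℕ b ≢ toℕ a
  b≢a e = a≢b (≡-sym e)
  sides : OppositeSides c d a b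
  sides with cyclic-side a≢c (λ e → b≢c (≡-sym e)) b≢a | cyclic-side a≢d (λ e → b≢d (≡-sym e)) b≢a
  ... | inj₁ (c-in , _) | inj₂ (d-out , _) = inj₁ (c-in , d-out)
  ... | inj₂ (c-out , _) | inj₁ (d-in , _) = inj₂ (c-out , d-in)
  ... | inj₁ (_ , c-or) | inj₁ (_ , d-or) = ⊥-elim (not-¬ refl (trans (≡-sym c-or) (trans separated (cong not d-or))))
  ... | inj₂ (_ , c-or) | inj₂ (_ , d-or) = ⊥-elim (not-¬ refl (trans (≡-sym c-or) (trans separated (cong not d-or))))

interleaved-crosses : ∀ {a x c y} → a < x → x < c → c < y → Crosses a c x y × Crosses x y a c
interleaved-crosses {a} {x} {c} {y} a<x x<c c<y =
  (distinct , trans (cyclic-ordered a<x x<c) (cong not (≡-sym (cyclic-misordered a<c c<y)))) ,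
  (distinct′ , trans (cyclic-rotate x a y)
                     (trans (cyclic-misordered a<x x<y) (cong not (≡-sym (cyclic-ordered x<c c<y)))))
  where
  a<c : a < c
  a<c = <-trans a<x x<c
  a<y : a < y
  a<y = <-trans a<c c<y
  x<y : x < y
  x<y = <-trans x<c c<y
  <⇒≢′ : ∀ {u v} → u < v → v ≢ u
  <⇒≢′ u<v v≡u = <⇒≢ u<v (≡-sym v≡u)
  distinct : Distinct4ℕ a c x y
  distinct = <⇒≢ a<c , <⇒≢ a<x , <⇒≢ a<y , <⇒≢′ x<c , <⇒≢ c<y , <⇒≢ x<y
  distinct′ : Distinct4ℕ x y a c
  distinct′ = <⇒≢ x<y , <⇒≢′ a<x , <⇒≢ x<c , <⇒≢′ a<y , <⇒≢′ c<y , <⇒≢ a<c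

Between-sym : ∀ {n} {x a b : Fin n} → Between x a b → Between x b a
Between-sym (inj₁ p) = inj₂ p
Between-sym (inj₂ p) = inj₁ p

Cross-swapˡ : ∀ {n} {a b c d : Fin n} → Cross a b c d → Cross b a c d
Cross-swapˡ {a = a} {b} {c} {d} ((a≢b , a≢c , a≢d , b≢c , b≢d , c≢d) , sides) =
  ((λ e → a≢b (≡-sym e)) , b≢c , b≢d , a≢c , a≢d , c≢d) , swap-sides sides
  where
  swap-sides : OppositeSides c d a b → OppositeSides c d b a
  swap-sides (inj₁ (c-in , d-out)) = inj₁ (Between-sym c-in , λ d-in → d-out (Between-sym d-in))
  swap-sides (inj₂ (c-out , d-in)) = inj₂ ((λ c-in → c-out (Between-sym c-in)) , Between-sym d-in)

Cross-swapʳ : ∀ {n} {a b c d : Fin n} → Cross a b c d → Cross a b d c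
Cross-swapʳ {a = a} {b} {c} {d} ((a≢b , a≢c , a≢d , b≢c , b≢d , c≢d) , sides) =
  (a≢b , a≢d , a≢c , b≢d , b≢c , (λ e → c≢d (≡-sym e))) , swap-sides sides
  where
  swap-sides : OppositeSides c d a b → OppositeSides d c a b
  swap-sides (inj₁ (c-in , d-out)) = inj₂ (d-out , c-in)
  swap-sides (inj₂ (c-out , d-in)) = inj₁ (d-in , c-out)

Cross-SamePair : ∀ {n} {a c x y p₁ p₂ q₁ q₂ : Fin n} → SamePair a c p₁ p₂ → SamePair x y q₁ q₂ →
  Cross a c x y → Cross p₁ p₂ q₁ q₂
Cross-SamePair (inj₁ (refl , refl)) (inj₁ (refl , refl)) cr = cr
Cross-SamePair (inj₁ (refl , refl)) (inj₂ (refl , refl)) cr = Cross-swapʳ cr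
Cross-SamePair (inj₂ (refl , refl)) (inj₁ (refl , refl)) cr = Cross-swapˡ cr
Cross-SamePair (inj₂ (refl , refl)) (inj₂ (refl , refl)) cr = Cross-swapˡ (Cross-swapʳ cr)

record Relabelling (n : ℕ) (f : ℕ → ℕ) : Set where
  field
    bounded   : ∀ {x} → x < n → f x < n
    injective : ∀ {x y} → x < n → y < n → f x ≡ f y → x ≡ y
    crossing  : ∀ {a b c d} → a < n → b < n → c < n → d < n →
                Crosses a b c d → Crosses (f a) (f b) (f c) (f d)

module _ {n : ℕ} where

  orientation⇒relabelling : ∀ (f : ℕ → ℕ) (σ : Bool → Bool) → (∀ b → σ (not b) ≡ not (σ b)) →
    (∀ {x} → x < n → f x < n) → (∀ {x y} → x < n → y < n → f x ≡ f y → x ≡ y) →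
    (∀ {x y z} → x < n → y < n → z < n → x ≢ y → y ≢ z → z ≢ x →
       cyclic (f x) (f y) (f z) ≡ σ (cyclic x y z)) →
    Relabelling n f
  orientation⇒relabelling f σ σ-not bounded injective oriented = record
    { bounded = bounded ; injective = injective ; crossing = crossing }
    where
    crossing : ∀ {a b c d} → a < n → b < n → c < n → d < n →
               Crosses a b c d → Crosses (f a) (f b) (f c) (f d)
    crossing {a} {b} {c} {d} a< b< c< d< ((a≢b , a≢c , a≢d , b≢c , b≢d , c≢d) , separated) =
      (inj a< b< a≢b , inj a< c< a≢c , inj a< d< a≢d , inj b< c< b≢c , inj b< d< b≢d , inj c< d< c≢d) ,
      (begin
        cyclic (f a) (f c) (f b)  ≡⟨ oriented a< c< b< a≢c (λ e → b≢c (≡-sym e)) (λ e → a≢b (≡-sym e)) ⟩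
        σ (cyclic a c b)          ≡⟨ cong σ separated ⟩
        σ (not (cyclic a d b))    ≡⟨ σ-not (cyclic a d b) ⟩
        not (σ (cyclic a d b))
          ≡⟨ cong not (≡-sym (oriented a< d< b< a≢d (λ e → b≢d (≡-sym e)) (λ e → a≢b (≡-sym e)))) ⟩
        not (cyclic (f a) (f d) (f b)) ∎)
      where
      open ≡-Reasoning
      inj : ∀ {x y} → x < n → y < n → x ≢ y → f x ≢ f y
      inj x< y< x≢y fx≡fy = x≢y (injective x< y< fx≡fy)

  relabelling-id : Relabelling n (λ x → x)
  relabelling-id = record { bounded = λ x< → x< ; injective = λ _ _ e → e ; crossing = λ _ _ _ _ cr → cr }

  relabelling-∘ : ∀ {f g} → Relabelling n f → Relabelling n g → Relabelling n (λ x → g (f x))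
  relabelling-∘ F G = record
    { bounded   = λ x< → G.bounded (F.bounded x<)
    ; injective = λ x< y< e → F.injective x< y< (G.injective (F.bounded x<) (F.bounded y<) e)
    ; crossing  = λ a< b< c< d< cr →
        G.crossing (F.bounded a<) (F.bounded b<) (F.bounded c<) (F.bounded d<) (F.crossing a< b< c< d< cr)
    }
    where
    module F = Relabelling F
    module G = Relabelling G

  relabelling-cong : ∀ {f g} → (∀ {x} → x < n → f x ≡ g x) → Relabelling n f → Relabelling n g
  relabelling-cong {f} {g} f≗g F = record
    { bounded   = λ x< → subst (_< n) (f≗g x<) (F.bounded x<)
    ; injective = λ x< y< e → F.injective x< y< (trans (f≗g x<) (trans e (≡-sym (f≗g y<))))
    ; crossing  = λ a< b< c< d< cr →
        subst₄ (f≗g a<) (f≗g b<) (f≗g c<) (f≗g d<) (F.crossing a< b< c< d< cr)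
    }
    where
    module F = Relabelling F
    subst₄ : ∀ {a a′ b b′ c c′ d d′} → a ≡ a′ → b ≡ b′ → c ≡ c′ → d ≡ d′ →
             Crosses a b c d → Crosses a′ b′ c′ d′
    subst₄ refl refl refl refl cr = cr

module Symmetries (n : ℕ) .{{_ : NonZero n}} where

  rotate1 : ℕ → ℕ
  rotate1 x = suc x % n

  rotate1-inner : ∀ {x} → suc x < n → rotate1 x ≡ suc x
  rotate1-inner = m<n⇒m%n≡m

  rotate1-last : ∀ {x} → suc x ≡ n → rotate1 x ≡ 0
  rotate1-last refl = n%n≡0 n

  rotate1-injective : ∀ {x y} → x < n → y < n → rotate1 x ≡ rotate1 y → x ≡ y
  rotate1-injective {x} {y} x< y< e with m≤n⇒m<n∨m≡n x< | m≤n⇒m<n∨m≡n y<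
  ... | inj₁ x+1< | inj₁ y+1< = suc-injective (trans (≡-sym (rotate1-inner x+1<)) (trans e (rotate1-inner y+1<)))
  ... | inj₂ x+1≡ | inj₂ y+1≡ = suc-injective (trans x+1≡ (≡-sym y+1≡))
  ... | inj₁ x+1< | inj₂ y+1≡ with () ← trans (≡-sym (rotate1-inner x+1<)) (trans e (rotate1-last y+1≡))
  ... | inj₂ x+1≡ | inj₁ y+1< with () ← trans (≡-sym (rotate1-inner y+1<)) (trans (≡-sym e) (rotate1-last x+1≡))

  below-last : ∀ {u z} → suc u < n → suc z ≡ n → u < z
  below-last u+1< refl = s≤s⁻¹ u+1<

  rotate1-wrap : ∀ {x y z} → suc x < n → suc y < n → suc z ≡ n →
                 cyclic (rotate1 x) (rotate1 y) (rotate1 z) ≡ cyclic x y z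
  rotate1-wrap {x} {y} {z} x+1< y+1< z+1≡
    rewrite rotate1-inner x+1< | rotate1-inner y+1< | rotate1-last z+1≡
          | <ᵇ-true (below-last y+1< z+1≡) | <ᵇ-false (<⇒≤ (below-last x+1< z+1≡))
    = majority-swap₂₃ (x <ᵇ y)

  -- Rotation by one step preserves orientation: at most one of three distinct
  -- points wraps around, and orientation is invariant under rotating the triple.
  rotate1-oriented : ∀ {x y z} → x < n → y < n → z < n → x ≢ y → y ≢ z → z ≢ x →
                     cyclic (rotate1 x) (rotate1 y) (rotate1 z) ≡ cyclic x y z
  rotate1-oriented {x} {y} {z} x< y< z< x≢y y≢z z≢x
    with m≤n⇒m<n∨m≡n x< | m≤n⇒m<n∨m≡n y< | m≤n⇒m<n∨m≡n z<
  ... | inj₁ x+1< | inj₁ y+1< | inj₁ z+1<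
    rewrite rotate1-inner x+1< | rotate1-inner y+1< | rotate1-inner z+1< = refl
  ... | inj₁ x+1< | inj₁ y+1< | inj₂ z+1≡ = rotate1-wrap x+1< y+1< z+1≡
  ... | inj₂ x+1≡ | inj₁ y+1< | inj₁ z+1< = begin
    cyclic (rotate1 x) (rotate1 y) (rotate1 z) ≡⟨ cyclic-rotate (rotate1 x) (rotate1 y) (rotate1 z) ⟩
    cyclic (rotate1 y) (rotate1 z) (rotate1 x) ≡⟨ rotate1-wrap y+1< z+1< x+1≡ ⟩
    cyclic y z x                               ≡⟨ cyclic-rotate x y z ⟨
    cyclic x y z                               ∎
    where open ≡-Reasoning
  ... | inj₁ x+1< | inj₂ y+1≡ | inj₁ z+1< = begin
    cyclic (rotate1 x) (rotate1 y) (rotate1 z) ≡⟨ cyclic-rotate (rotate1 z) (rotate1 x) (rotate1 y) ⟨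
    cyclic (rotate1 z) (rotate1 x) (rotate1 y) ≡⟨ rotate1-wrap z+1< x+1< y+1≡ ⟩
    cyclic z x y                               ≡⟨ cyclic-rotate z x y ⟩
    cyclic x y z                               ∎
    where open ≡-Reasoning
  ... | inj₂ x+1≡ | inj₂ y+1≡ | _ = ⊥-elim (x≢y (suc-injective (trans x+1≡ (≡-sym y+1≡))))
  ... | _ | inj₂ y+1≡ | inj₂ z+1≡ = ⊥-elim (y≢z (suc-injective (trans y+1≡ (≡-sym z+1≡))))
  ... | inj₂ x+1≡ | _ | inj₂ z+1≡ = ⊥-elim (z≢x (suc-injective (trans z+1≡ (≡-sym x+1≡))))

  rotate1-relabelling : Relabelling n rotate1
  rotate1-relabelling =
    orientation⇒relabelling rotate1 (λ b → b) (λ _ → refl) (λ {x} _ → m%n<n (suc x) n)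
      rotate1-injective rotate1-oriented

  rotate : ℕ → ℕ → ℕ
  rotate R x = (R + x) % n

  rotate-suc : ∀ R x → rotate (suc R) x ≡ rotate1 (rotate R x)
  rotate-suc R x = begin
    (1 + (R + x)) % n                  ≡⟨ %-distribˡ-+ 1 (R + x) n ⟩
    (1 % n + (R + x) % n) % n          ≡⟨ cong (λ t → (1 % n + t) % n) (m%n%n≡m%n (R + x) n) ⟨
    (1 % n + (R + x) % n % n) % n      ≡⟨ %-distribˡ-+ 1 ((R + x) % n) n ⟨
    (1 + (R + x) % n) % n              ∎
    where open ≡-Reasoning

  rotate-relabelling : ∀ R → Relabelling n (rotate R)
  rotate-relabelling zero =
    relabelling-cong (λ x< → ≡-sym (m<n⇒m%n≡m x<)) relabelling-id
  rotate-relabelling (suc R) =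
    relabelling-cong (λ {x} _ → ≡-sym (rotate-suc R x))
      (relabelling-∘ (rotate-relabelling R) rotate1-relabelling)

  reflect : ℕ → ℕ
  reflect x = n ∸ suc x

  reflect-<ᵇ : ∀ {x y} → x < n → (reflect x <ᵇ reflect y) ≡ (y <ᵇ x)
  reflect-<ᵇ {x} {y} x< with <-cmp y x
  ... | tri< y<x _ _ = trans (<ᵇ-true (∸-monoʳ-< (s≤s y<x) x<)) (≡-sym (<ᵇ-true y<x))
  ... | tri≈ _ refl _ = trans (<ᵇ-false {reflect x} ≤-refl) (≡-sym (<ᵇ-false {x} ≤-refl))
  ... | tri> _ _ x<y = trans (<ᵇ-false (∸-monoʳ-≤ n (s≤s (<⇒≤ x<y)))) (≡-sym (<ᵇ-false (<⇒≤ x<y)))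

  reflect-oriented : ∀ {x y z} → x < n → y < n → z < n → x ≢ y → y ≢ z → z ≢ x →
                     cyclic (reflect x) (reflect y) (reflect z) ≡ not (cyclic x y z)
  reflect-oriented {x} {y} {z} x< y< z< x≢y y≢z z≢x = begin
    majority (reflect x <ᵇ reflect y) (reflect y <ᵇ reflect z) (reflect z <ᵇ reflect x)
      ≡⟨ cong₂ (λ a b → majority a b (reflect z <ᵇ reflect x)) (reflect-<ᵇ x<) (reflect-<ᵇ y<) ⟩
    majority (y <ᵇ x) (z <ᵇ y) (reflect z <ᵇ reflect x)
      ≡⟨ cong (majority (y <ᵇ x) (z <ᵇ y)) (reflect-<ᵇ z<) ⟩
    majority (y <ᵇ x) (z <ᵇ y) (x <ᵇ z)
      ≡⟨ majority-swap (y <ᵇ x) (z <ᵇ y) (x <ᵇ z) ⟩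
    cyclic z y x
      ≡⟨ cyclic-reverse x≢y y≢z z≢x ⟩
    not (cyclic x y z) ∎
    where open ≡-Reasoning

  reflect-relabelling : Relabelling n reflect
  reflect-relabelling =
    orientation⇒relabelling reflect not (λ _ → refl) (λ x< → ∸-monoʳ-< {n} {_} {0} (s≤s z≤n) x<)
      (λ x< y< e → suc-injective (∸-cancelˡ-≡ x< y< e)) reflect-oriented

module LabellingFacts (n : ℕ) .{{_ : NonZero n}} (s : Fin n) where
  open Symmetries n
  open ≡-Reasoning

  private
    S : ℕ
    S = toℕ s

  toℕ-mod : ∀ m → toℕ (m mod n) ≡ m % n
  toℕ-mod m = Fin.toℕ-fromℕ< (m%n<n m n)

  %-absorbʳ : ∀ a b → (a + b % n) % n ≡ (a + b) % n
  %-absorbʳ a b = begin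
    (a + b % n) % n           ≡⟨ %-distribˡ-+ a (b % n) n ⟩
    (a % n + b % n % n) % n   ≡⟨ cong (λ t → (a % n + t) % n) (m%n%n≡m%n b n) ⟩
    (a % n + b % n) % n       ≡⟨ %-distribˡ-+ a b n ⟨
    (a + b) % n               ∎

  ∸-suc : ∀ {u} → u < n → n ∸ u ≡ suc (n ∸ suc u)
  ∸-suc u< = +-∸-assoc 1 u<

  labelling-true : ∀ R t → toℕ (Labelling s true (R + t)) ≡ rotate S (rotate R t)
  labelling-true R t = trans (toℕ-mod (S + (R + t))) (≡-sym (%-absorbʳ S (R + t)))

  -- Backwards labelling: reflect, then shift by one so that index 0 stays at s.
  labelling-false : ∀ R t → toℕ (Labelling s false (R + t)) ≡ rotate S (rotate1 (reflect (rotate R t)))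
  labelling-false R t = begin
    toℕ ((S + (n ∸ (R + t) % n)) mod n)     ≡⟨ toℕ-mod (S + (n ∸ (R + t) % n)) ⟩
    (S + (n ∸ (R + t) % n)) % n             ≡⟨ cong (λ z → (S + z) % n) (∸-suc (m%n<n (R + t) n)) ⟩
    (S + suc (n ∸ suc ((R + t) % n))) % n   ≡⟨ %-absorbʳ S (suc (n ∸ suc ((R + t) % n))) ⟨
    rotate S (rotate1 (reflect (rotate R t))) ∎

  labelling-relabelling : ∀ o R → Relabelling n (λ t → toℕ (Labelling s o (R + t)))
  labelling-relabelling true R =
    relabelling-cong (λ {t} _ → ≡-sym (labelling-true R t))
      (relabelling-∘ (rotate-relabelling R) (rotate-relabelling S))
  labelling-relabelling false R =
    relabelling-cong (λ {t} _ → ≡-sym (labelling-false R t))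
      (relabelling-∘ (rotate-relabelling R)
        (relabelling-∘ reflect-relabelling (relabelling-∘ rotate1-relabelling (rotate-relabelling S))))

  labelling-periodic : ∀ o r → Labelling s o (n + r) ≡ Labelling s o r
  labelling-periodic true r = Fin.toℕ-injective (begin
    toℕ ((S + (n + r)) mod n)   ≡⟨ toℕ-mod (S + (n + r)) ⟩
    (S + (n + r)) % n           ≡⟨ cong (_% n) (trans (cong (S +_) (+-comm n r)) (≡-sym (+-assoc S r n))) ⟩
    (S + r + n) % n             ≡⟨ [m+n]%n≡m%n (S + r) n ⟩
    (S + r) % n                 ≡⟨ toℕ-mod (S + r) ⟨
    toℕ ((S + r) mod n)         ∎)
  labelling-periodic false r =
    cong (λ z → (S + (n ∸ z)) mod n) (trans (cong (_% n) (+-comm n r)) ([m+n]%n≡m%n r n))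

  toℕ-next : ∀ (x : Fin n) → toℕ (next x) ≡ suc (toℕ x) % n
  toℕ-next x = toℕ-mod (suc (toℕ x))

  labelling-step-true : ∀ r → toℕ (Labelling s true (suc r)) ≡ suc (toℕ (Labelling s true r)) % n
  labelling-step-true r = begin
    toℕ ((S + suc r) mod n)        ≡⟨ toℕ-mod (S + suc r) ⟩
    (S + suc r) % n                ≡⟨ cong (_% n) (+-suc S r) ⟩
    (1 + (S + r)) % n              ≡⟨ %-absorbʳ 1 (S + r) ⟨
    suc ((S + r) % n) % n          ≡⟨ cong (λ z → suc z % n) (toℕ-mod (S + r)) ⟨
    suc (toℕ ((S + r) mod n)) % n  ∎

  labelling-step-false : ∀ r → toℕ (Labelling s false r) ≡ suc (toℕ (Labelling s false (suc r))) % n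
  labelling-step-false r = begin
    toℕ ((S + (n ∸ r % n)) mod n)                 ≡⟨ toℕ-mod (S + (n ∸ r % n)) ⟩
    (S + (n ∸ r % n)) % n                         ≡⟨ shift ⟩
    (S + suc (n ∸ suc r % n)) % n                 ≡⟨ cong (_% n) (+-suc S (n ∸ suc r % n)) ⟩
    (1 + (S + (n ∸ suc r % n))) % n               ≡⟨ %-absorbʳ 1 (S + (n ∸ suc r % n)) ⟨
    suc ((S + (n ∸ suc r % n)) % n) % n           ≡⟨ cong (λ z → suc z % n) (toℕ-mod (S + (n ∸ suc r % n))) ⟨
    suc (toℕ ((S + (n ∸ suc r % n)) mod n)) % n   ∎
    where
    suc-% : suc r % n ≡ suc (r % n) % n
    suc-% = ≡-sym (%-absorbʳ 1 r)
    shift : (S + (n ∸ r % n)) % n ≡ (S + suc (n ∸ suc r % n)) % n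
    shift with m≤n⇒m<n∨m≡n (m%n<n r n)
    ... | inj₁ r%n+1< = begin
      (S + (n ∸ r % n)) % n              ≡⟨ cong (λ z → (S + z) % n) (∸-suc (m%n<n r n)) ⟩
      (S + suc (n ∸ suc (r % n))) % n    ≡⟨ cong (λ z → (S + suc (n ∸ z)) % n) (trans suc-% (m<n⇒m%n≡m r%n+1<)) ⟨
      (S + suc (n ∸ suc r % n)) % n      ∎
    ... | inj₂ r%n+1≡n = begin
      (S + (n ∸ r % n)) % n              ≡⟨ cong (λ z → (S + z) % n) last ⟩
      (S + 1) % n                        ≡⟨ [m+n]%n≡m%n (S + 1) n ⟨
      (S + 1 + n) % n                    ≡⟨ cong (_% n) (+-assoc S 1 n) ⟩
      (S + suc n) % n                    ≡⟨ cong (λ z → (S + suc (n ∸ z)) % n) first ⟨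
      (S + suc (n ∸ suc r % n)) % n      ∎
      where
      last : n ∸ r % n ≡ 1
      last = trans (∸-suc (m%n<n r n)) (cong suc (trans (cong (n ∸_) r%n+1≡n) (n∸n≡0 n)))
      first : suc r % n ≡ 0
      first = trans suc-% (trans (cong (_% n) r%n+1≡n) (n%n≡0 n))

  labelling-boundary : ∀ o r → IsBoundary (Labelling s o r) (Labelling s o (suc r))
  labelling-boundary true r =
    inj₁ (Fin.toℕ-injective (trans (labelling-step-true r) (≡-sym (toℕ-next (Labelling s true r)))))
  labelling-boundary false r =
    inj₂ (Fin.toℕ-injective (trans (labelling-step-false r) (≡-sym (toℕ-next (Labelling s false (suc r))))))

module _ {A : Set} where

  indicator : ∀ {P : Set} → Dec P → ℕ
  indicator (yes _) = 1
  indicator (no _)  = 0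

  count : ∀ {P : A → Set} → (∀ x → Dec (P x)) → List A → ℕ
  count P? []       = 0
  count P? (x ∷ xs) = indicator (P? x) + count P? xs

  count-cover : ∀ {P Q R : A → Set} (P? : ∀ x → Dec (P x)) (Q? : ∀ x → Dec (Q x)) (R? : ∀ x → Dec (R x)) →
    (xs : List A) → (∀ {z} → z ∈ xs → P z → Q z ⊎ R z) → count P? xs ≤ count Q? xs + count R? xs
  count-cover P? Q? R? []       cover = z≤n
  count-cover P? Q? R? (x ∷ xs) cover = begin
    indicator (P? x) + count P? xs
      ≤⟨ +-mono-≤ (head-cover (cover (here refl)) (P? x) (Q? x) (R? x))
                  (count-cover P? Q? R? xs (λ z∈ → cover (there z∈))) ⟩
    (indicator (Q? x) + indicator (R? x)) + (count Q? xs + count R? xs)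
      ≡⟨ interchange (indicator (Q? x)) (indicator (R? x)) (count Q? xs) (count R? xs) ⟩
    (indicator (Q? x) + count Q? xs) + (indicator (R? x) + count R? xs) ∎
    where
    open ≤-Reasoning
    interchange : ∀ a b c d → (a + b) + (c + d) ≡ (a + c) + (b + d)
    interchange = solve-∀
    head-cover : ∀ {P Q R : Set} → (P → Q ⊎ R) → (p : Dec P) (q : Dec Q) (r : Dec R) →
                 indicator p ≤ indicator q + indicator r
    head-cover h (no _)  q       r       = z≤n
    head-cover h (yes _) (yes _) r       = s≤s z≤n
    head-cover h (yes _) (no _)  (yes _) = s≤s z≤n
    head-cover h (yes p) (no ¬q) (no ¬r) with h p
    ... | inj₁ q = ⊥-elim (¬q q)
    ... | inj₂ r = ⊥-elim (¬r r)

  count-none : ∀ {P : A → Set} (P? : ∀ x → Dec (P x)) (xs : List A) →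
    (∀ {z} → z ∈ xs → ¬ P z) → count P? xs ≡ 0
  count-none P? []       none = refl
  count-none P? (x ∷ xs) none with P? x
  ... | yes p = ⊥-elim (none (here refl) p)
  ... | no _  = count-none P? xs (λ z∈ → none (there z∈))

  count-all : ∀ {P : A → Set} (P? : ∀ x → Dec (P x)) (xs : List A) →
    (∀ {z} → z ∈ xs → P z) → count P? xs ≡ length xs
  count-all P? []       all = refl
  count-all P? (x ∷ xs) all with P? x
  ... | yes _ = cong suc (count-all P? xs (λ z∈ → all (there z∈)))
  ... | no ¬p = ⊥-elim (¬p (all (here refl)))

  count-positive : ∀ {P : A → Set} (P? : ∀ x → Dec (P x)) (xs : List A) →
    0 < count P? xs → ∃[ z ] (z ∈ xs × P z)
  count-positive P? (x ∷ xs) pos with P? x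
  ... | yes p = x , here refl , p
  ... | no _ with count-positive P? xs pos
  ...   | z , z∈ , p = z , there z∈ , p

  count-unique : ∀ (e : A) (_≟e : ∀ x → Dec (x ≡ e)) (xs : List A) → Unique xs → count _≟e xs ≤ 1
  count-unique e _≟e []       []           = z≤n
  count-unique e _≟e (x ∷ xs) (x∉ ∷ uniq) with x ≟e
  ... | no _     = count-unique e _≟e xs uniq
  ... | yes refl = s≤s (≤-reflexive (count-none _≟e xs (λ z∈ z≡x → All.lookup x∉ z∈ (≡-sym z≡x))))

-- Linear arithmetic for the counting argument below.  Throughout, a < c < b,
-- K counts chords inside [a,b], and X, Y bound the chords on either side of c.
module ChordArithmetic where
  open ≤-Reasoning

  -- A side of width c - a: itself (if a chord) plus the chords inside it.
  side-bound : ∀ e k a c → e ≤ 1 → k + suc (suc a) ≤ c → e + k + suc a ≤ c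
  side-bound e k a c e≤1 k-bound = begin
    e + k + suc a      ≤⟨ +-monoˡ-≤ (suc a) (+-monoˡ-≤ k e≤1) ⟩
    1 + k + suc a      ≡⟨ shuffle k a ⟩
    k + suc (suc a)    ≤⟨ k-bound ⟩
    c                  ∎
    where
    shuffle : ∀ k a → 1 + k + suc a ≡ k + suc (suc a)
    shuffle = solve-∀

  -- The two sides of the apex together leave room for at most b - a - 2 chords.
  sum-bound : ∀ K X Y a b c → K ≤ X + Y → X + suc a ≤ c → Y + suc c ≤ b → K + suc (suc a) ≤ b
  sum-bound K X Y a b c K≤ X-bound Y-bound = begin
    K + suc (suc a)          ≤⟨ +-monoˡ-≤ (suc (suc a)) K≤ ⟩
    X + Y + suc (suc a)      ≡⟨ shuffle X Y a ⟩
    (X + suc a) + suc Y      ≤⟨ +-monoˡ-≤ (suc Y) X-bound ⟩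
    c + suc Y                ≡⟨ +-comm c (suc Y) ⟩
    suc Y + c                ≡⟨ +-suc Y c ⟨
    Y + suc c                ≤⟨ Y-bound ⟩
    b                        ∎
    where
    shuffle : ∀ X Y a → X + Y + suc (suc a) ≡ (X + suc a) + suc Y
    shuffle = solve-∀

  -- If [a,b] is saturated, so is the left side [a,c] …
  left-saturated : ∀ K e k Y a b c → b ≤ K + suc (suc a) → K ≤ (e + k) + Y → Y + suc c ≤ b → e ≤ 1 →
    c ≤ k + suc (suc a)
  left-saturated K e k Y a b c saturated K≤ Y-bound e≤1 = ≤-trans c≤ (side-bound e k a _ e≤1 ≤-refl)
    where
    shuffle : ∀ X Y a → X + Y + suc (suc a) ≡ Y + suc (X + suc a)
    shuffle = solve-∀
    c≤ : c ≤ e + k + suc a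
    c≤ = s≤s⁻¹ (+-cancelˡ-≤ Y _ _ (begin
      Y + suc c                     ≤⟨ Y-bound ⟩
      b                             ≤⟨ saturated ⟩
      K + suc (suc a)               ≤⟨ +-monoˡ-≤ (suc (suc a)) K≤ ⟩
      e + k + Y + suc (suc a)       ≡⟨ shuffle (e + k) Y a ⟩
      Y + suc (e + k + suc a)       ∎))

  -- … and so is the right side [c,b] …
  right-saturated : ∀ K X e k a b c → b ≤ K + suc (suc a) → K ≤ X + (e + k) → X + suc a ≤ c → e ≤ 1 →
    b ≤ k + suc (suc c)
  right-saturated K X e k a b c saturated K≤ X-bound e≤1 = begin
    b                              ≤⟨ saturated ⟩
    K + suc (suc a)                ≤⟨ +-monoˡ-≤ (suc (suc a)) K≤ ⟩
    X + (e + k) + suc (suc a)      ≡⟨ shuffle₁ X (e + k) a ⟩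
    (X + suc a) + suc (e + k)      ≤⟨ +-monoˡ-≤ (suc (e + k)) X-bound ⟩
    c + suc (e + k)                ≤⟨ +-monoʳ-≤ c (s≤s (+-monoˡ-≤ k e≤1)) ⟩
    c + suc (1 + k)                ≡⟨ shuffle₂ c k ⟩
    k + suc (suc c)                ∎
    where
    shuffle₁ : ∀ X Z a → X + Z + suc (suc a) ≡ (X + suc a) + suc Z
    shuffle₁ = solve-∀
    shuffle₂ : ∀ c k → c + suc (1 + k) ≡ k + suc (suc c)
    shuffle₂ = solve-∀

  -- … and the right side cannot be saturated without its base being a chord.
  right-base-missing : ∀ K X k a b c → b ≤ K + suc (suc a) → K ≤ X + k → X + suc a ≤ c →
    k + suc (suc c) ≤ b → ⊥
  right-base-missing K X k a b c saturated K≤ X-bound k-bound = <-irrefl refl (begin-strict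
    suc (k + c)               <⟨ ≤-refl ⟩
    suc (suc (k + c))         ≡⟨ shuffle₁ k c ⟩
    k + suc (suc c)           ≤⟨ k-bound ⟩
    b                         ≤⟨ saturated ⟩
    K + suc (suc a)           ≤⟨ +-monoˡ-≤ (suc (suc a)) K≤ ⟩
    X + k + suc (suc a)       ≡⟨ shuffle₂ X k a ⟩
    (X + suc a) + suc k       ≤⟨ +-monoˡ-≤ (suc k) X-bound ⟩
    c + suc k                 ≡⟨ shuffle₃ c k ⟩
    suc (k + c)               ∎)
    where
    shuffle₁ : ∀ k c → suc (suc (k + c)) ≡ k + suc (suc c)
    shuffle₁ = solve-∀
    shuffle₂ : ∀ X k a → X + k + suc (suc a) ≡ (X + suc a) + suc k
    shuffle₂ = solve-∀
    shuffle₃ : ∀ c k → c + suc k ≡ suc (k + c)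
    shuffle₃ = solve-∀

module ChordFamily (L : List (ℕ × ℕ)) (unique : Unique L)
  (chord : ∀ {x y} → (x , y) ∈ L → suc x < y)
  (non-interleaving : ∀ {a x c y} → (a , c) ∈ L → (x , y) ∈ L → a < x → x < c → c < y → ⊥) where

  open ChordArithmetic

  _≟pair_ : ∀ (p q : ℕ × ℕ) → Dec (p ≡ q)
  _≟pair_ = ≡-dec _≟_ _≟_

  open import Data.List.Membership.DecPropositional _≟pair_ using (_∈?_)

  Inside : ℕ → ℕ → ℕ × ℕ → Set
  Inside a b (x , y) = a ≤ x × y ≤ b × ¬ (x ≡ a × y ≡ b)

  inside? : ∀ a b z → Dec (Inside a b z)
  inside? a b (x , y) = (a ≤? x) ×-dec ((y ≤? b) ×-dec ¬? ((x ≟ a) ×-dec (y ≟ b)))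

  inside : ℕ → ℕ → ℕ
  inside a b = count (inside? a b) L

  copies : ℕ × ℕ → ℕ
  copies e = count (_≟pair e) L

  copies≤1 : ∀ e → copies e ≤ 1
  copies≤1 e = count-unique e (_≟pair e) L unique

  copies-positive : ∀ e → 0 < copies e → e ∈ L
  copies-positive e pos with count-positive (_≟pair e) L pos
  ... | _ , e∈ , refl = e∈

  copies-edge : ∀ a → copies (a , suc a) ≡ 0
  copies-edge a = count-none _ L λ { z∈ refl → <-irrefl refl (chord z∈) }

  inside-edge : ∀ a → inside a (suc a) ≡ 0
  inside-edge a = count-none _ L λ { {x , y} z∈ (a≤x , y≤a+1 , _) →
    <-irrefl refl (≤-trans (chord z∈) (≤-trans y≤a+1 (s≤s a≤x))) }

  reach : ℕ → ℕ → ℕ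
  reach a zero = suc a
  reach a (suc y) with (a , suc y) ∈? L
  ... | yes _ = suc y
  ... | no _  = reach a y

  reach-side : ∀ a y → reach a y ≡ suc a ⊎ ((a , reach a y) ∈ L × reach a y ≤ y)
  reach-side a zero = inj₁ refl
  reach-side a (suc y) with (a , suc y) ∈? L
  ... | yes ∈L = inj₂ (∈L , ≤-refl)
  ... | no _ with reach-side a y
  ...   | inj₁ reach≡a+1 = inj₁ reach≡a+1
  ...   | inj₂ (∈L , ≤y)  = inj₂ (∈L , m≤n⇒m≤1+n ≤y)

  reach-maximal : ∀ a y {z} → reach a y < z → z ≤ y → (a , z) ∈ L → ⊥
  reach-maximal a zero    () z≤n _
  reach-maximal a (suc y) {z} reach<z z≤y+1 ∈L with (a , suc y) ∈? L
  ... | yes _ = <-irrefl refl (<-≤-trans reach<z z≤y+1)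
  ... | no ∉L with m≤n⇒m<n∨m≡n z≤y+1
  ...   | inj₁ z<y+1 = reach-maximal a y reach<z (s≤s⁻¹ z<y+1) ∈L
  ...   | inj₂ refl  = ∉L ∈L

  reach-> : ∀ a y → a < reach a y
  reach-> a y with reach-side a y
  ... | inj₁ reach≡a+1 = subst (a <_) (≡-sym reach≡a+1) ≤-refl
  ... | inj₂ (∈L , _)  = <-trans (n<1+n a) (chord ∈L)

  -- The apex of the triangle on the base ab: the farthest vertex c < b joined to a.
  apex : ℕ → ℕ → ℕ
  apex a b = reach a (pred b)

  apex-< : ∀ a b → suc a < b → apex a b < b
  apex-< a (suc b) a+1<b+1 with reach-side a b
  ... | inj₁ reach≡a+1 = subst (_< suc b) (≡-sym reach≡a+1) a+1<b+1
  ... | inj₂ (_ , ≤b)  = s≤s ≤b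

  Side : ℕ → ℕ → Set
  Side a b = b ≡ suc a ⊎ (a , b) ∈ L

  apex-side : ∀ a b → Side a (apex a b)
  apex-side a b with reach-side a (pred b)
  ... | inj₁ reach≡a+1 = inj₁ reach≡a+1
  ... | inj₂ (∈L , _)  = inj₂ ∈L

  data Triangulated : ℕ → ℕ → Set where
    edge     : ∀ a → Triangulated a (suc a)
    triangle : ∀ {a b} c → a < c → c < b → Side a c → Side c b →
               Triangulated a c → Triangulated c b → Triangulated a b

  -- Every chord inside a … b is the side ac of the apex triangle, lies inside
  -- a … c, is the side cb, or lies inside c … b: otherwise it would interleave
  -- with ac or contradict the maximality of c.
  inside-split : ∀ a b → suc a < b → ∀ {z} → z ∈ L → Inside a b z →
    (z ≡ (a , apex a b) ⊎ Inside a (apex a b) z) ⊎ (z ≡ (apex a b , b) ⊎ Inside (apex a b) b z)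
  inside-split a b a+1<b {x , y} z∈ (a≤x , y≤b , not-base) with y ≤? apex a b
  ... | yes y≤c with x ≟ a | y ≟ apex a b
  ...   | yes refl | yes refl = inj₁ (inj₁ refl)
  ...   | yes refl | no y≢c   = inj₁ (inj₂ (a≤x , y≤c , λ { (_ , y≡c) → y≢c y≡c }))
  ...   | no x≢a   | _        = inj₁ (inj₂ (a≤x , y≤c , λ { (x≡a , _) → x≢a x≡a }))
  inside-split a b a+1<b {x , y} z∈ (a≤x , y≤b , not-base) | no y≰c with apex a b ≤? x
  ... | yes c≤x with x ≟ apex a b | y ≟ b
  ...   | yes refl | yes refl = inj₂ (inj₁ refl)
  ...   | yes refl | no y≢b   = inj₂ (inj₂ (c≤x , y≤b , λ { (_ , y≡b) → y≢b y≡b }))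
  ...   | no x≢c   | _        = inj₂ (inj₂ (c≤x , y≤b , λ { (x≡c , _) → x≢c x≡c }))
  inside-split a b a+1<b {x , y} z∈ (a≤x , y≤b , not-base) | no y≰c | no c≰x with x ≟ a
  ... | yes refl = ⊥-elim (reach-maximal a (pred b) (≰⇒> y≰c) (<⇒≤pred y<b) z∈)
    where
    y<b : y < b
    y<b = ≤∧≢⇒< y≤b (λ y≡b → not-base (refl , y≡b))
  ... | no x≢a with reach-side a (pred b)
  ...   | inj₁ reach≡a+1 =
    ⊥-elim (c≰x (subst (_≤ x) (≡-sym reach≡a+1) (≤∧≢⇒< a≤x (λ a≡x → x≢a (≡-sym a≡x)))))
  ...   | inj₂ (ac∈ , _) =
    ⊥-elim (non-interleaving ac∈ z∈ (≤∧≢⇒< a≤x (λ a≡x → x≢a (≡-sym a≡x))) (≰⇒> c≰x) (≰⇒> y≰c))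

  inside-split-count : ∀ a b → suc a < b →
    inside a b ≤ (copies (a , apex a b) + inside a (apex a b)) + (copies (apex a b , b) + inside (apex a b) b)
  inside-split-count a b a+1<b = ≤-trans (count-cover (inside? a b) left? right? L (inside-split a b a+1<b))
    (+-mono-≤ (count-cover left? (_≟pair (a , c)) (inside? a c) L (λ _ side → side))
              (count-cover right? (_≟pair (c , b)) (inside? c b) L (λ _ side → side)))
    where
    c : ℕ
    c = apex a b
    left? : ∀ z → Dec (z ≡ (a , c) ⊎ Inside a c z)
    left? z = (z ≟pair (a , c)) ⊎-dec inside? a c z
    right? : ∀ z → Dec (z ≡ (c , b) ⊎ Inside c b z)
    right? z = (z ≟pair (c , b)) ⊎-dec inside? c b z

  width-left : ∀ f a c b → b ∸ a ≤ suc f → a < c → c < b → c ∸ a ≤ f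
  width-left f a c b width a<c c<b = s≤s⁻¹ (<-≤-trans (∸-monoˡ-< c<b (<⇒≤ a<c)) width)

  width-right : ∀ f a c b → b ∸ a ≤ suc f → a < c → c < b → b ∸ c ≤ f
  width-right f a c b width a<c c<b = s≤s⁻¹ (<-≤-trans (∸-monoʳ-< a<c (<⇒≤ c<b)) width)

  inside-bound : ∀ f a b → b ∸ a ≤ f → suc a < b → inside a b + suc (suc a) ≤ b
  closed-bound : ∀ f a c → c ∸ a ≤ f → a < c → copies (a , c) + inside a c + suc a ≤ c

  inside-bound zero a b width a+1<b =
    ⊥-elim (<-irrefl refl (≤-trans (m<n⇒0<n∸m (<-trans (n<1+n a) a+1<b)) width))
  inside-bound (suc f) a b width a+1<b =
    sum-bound (inside a b) _ _ a b c (inside-split-count a b a+1<b)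
      (closed-bound f a c (width-left f a c b width a<c c<b) a<c)
      (closed-bound f c b (width-right f a c b width a<c c<b) c<b)
    where
    c : ℕ
    c = apex a b
    a<c : a < c
    a<c = reach-> a (pred b)
    c<b : c < b
    c<b = apex-< a b a+1<b

  closed-bound f a c width a<c with m≤n⇒m<n∨m≡n a<c
  ... | inj₂ refl rewrite copies-edge a | inside-edge a = ≤-refl
  ... | inj₁ a+1<c = side-bound (copies (a , c)) (inside a c) a c (copies≤1 _) (inside-bound f a c width a+1<c)

  -- A saturated polygon, containing the maximal number b - a - 2 of chords, is
  -- triangulated: by the bounds above both sides of the apex triangle are
  -- saturated, and its side cb is a chord unless it is an edge.
  saturated⇒triangulated : ∀ f a b → b ∸ a ≤ f → a < b → b ≤ inside a b + suc (suc a) → Triangulated a b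
  saturated⇒triangulated f a b width a<b saturated with m≤n⇒m<n∨m≡n a<b
  ... | inj₂ refl = edge a
  saturated⇒triangulated zero a b width a<b saturated | inj₁ _ =
    ⊥-elim (<-irrefl refl (≤-trans (m<n⇒0<n∸m a<b) width))
  saturated⇒triangulated (suc f) a b width a<b saturated | inj₁ a+1<b =
    triangle c a<c c<b (apex-side a b) side-cb
      (saturated⇒triangulated f a c width-ac a<c
        (left-saturated (inside a b) (copies (a , c)) (inside a c) _ a b c saturated split right (copies≤1 _)))
      (saturated⇒triangulated f c b width-cb c<b
        (right-saturated (inside a b) _ (copies (c , b)) (inside c b) a b c saturated split left (copies≤1 _)))
    where
    c : ℕ
    c = apex a b
    a<c : a < c
    a<c = reach-> a (pred b)
    c<b : c < b
    c<b = apex-< a b a+1<b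
    width-ac : c ∸ a ≤ f
    width-ac = width-left f a c b width a<c c<b
    width-cb : b ∸ c ≤ f
    width-cb = width-right f a c b width a<c c<b
    split : inside a b ≤ (copies (a , c) + inside a c) + (copies (c , b) + inside c b)
    split = inside-split-count a b a+1<b
    left : copies (a , c) + inside a c + suc a ≤ c
    left = closed-bound f a c width-ac a<c
    right : copies (c , b) + inside c b + suc c ≤ b
    right = closed-bound f c b width-cb c<b
    side-cb : Side c b
    side-cb with m≤n⇒m<n∨m≡n c<b
    ... | inj₂ c+1≡b = inj₁ (≡-sym c+1≡b)
    ... | inj₁ c+1<b with copies (c , b) in eq
    ...   | suc _ = inj₂ (copies-positive (c , b) (subst (0 <_) (≡-sym eq) (s≤s z≤n)))
    ...   | zero  = ⊥-elim (right-base-missing (inside a b) (copies (a , c) + inside a c) (inside c b) a b c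
                      saturated (subst (λ e → inside a b ≤ (copies (a , c) + inside a c) + (e + inside c b)) eq split) left
                      (inside-bound f c b width-cb c+1<b))

  ear : ∀ {a b} → Triangulated a b → Side a b → suc a < b →
        ∃[ t ] (a ≤ t × suc (suc t) ≤ b × (t , suc (suc t)) ∈ L)
  ear (edge a) _ a+1<a+1 = ⊥-elim (<-irrefl refl a+1<a+1)
  ear (triangle c a<c c<b ac cb tri-ac tri-cb) ab a+1<b with m≤n⇒m<n∨m≡n a<c | m≤n⇒m<n∨m≡n c<b
  ... | inj₁ a+1<c | _ with ear tri-ac ac a+1<c
  ...   | t , a≤t , t+2≤c , ∈L = t , a≤t , ≤-trans t+2≤c (<⇒≤ c<b) , ∈L
  ear (triangle c a<c c<b ac cb tri-ac tri-cb) ab a+1<b | inj₂ refl | inj₁ c+1<b with ear tri-cb cb c+1<b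
  ...   | t , c≤t , t+2≤b , ∈L = t , ≤-trans (<⇒≤ a<c) c≤t , t+2≤b , ∈L
  ear (triangle c a<c c<b ac cb tri-ac tri-cb) (inj₁ b≡a+1) a+1<b | inj₂ refl | inj₂ refl =
    ⊥-elim (<-irrefl (≡-sym b≡a+1) a+1<b)
  ear {a} (triangle c a<c c<b ac cb tri-ac tri-cb) (inj₂ ∈L) a+1<b | inj₂ refl | inj₂ refl = a , ≤-refl , ≤-refl , ∈L

  polygon-triangulated : ∀ n → 3 ≤ n → length L ≡ n ∸ 3 →
    (∀ {x y} → (x , y) ∈ L → y ≤ n ∸ 1 × ¬ (x ≡ 0 × y ≡ n ∸ 1)) → Triangulated 0 (n ∸ 1)
  polygon-triangulated (suc (suc (suc n))) (s≤s (s≤s (s≤s z≤n))) length≡ within =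
    saturated⇒triangulated (suc (suc n)) 0 (suc (suc n)) ≤-refl (s≤s z≤n) (≤-reflexive (begin
      suc (suc n)                   ≡⟨ cong (λ t → suc (suc t)) length≡ ⟨
      suc (suc (length L))          ≡⟨ +-comm 2 (length L) ⟩
      length L + 2                  ≡⟨ cong (_+ 2) all-inside ⟨
      inside 0 (suc (suc n)) + 2    ∎))
    where
    open ≡-Reasoning
    all-inside : inside 0 (suc (suc n)) ≡ length L
    all-inside = count-all (inside? 0 (suc (suc n))) L (λ { {x , y} z∈ → z≤n , within z∈ })

  -- Case (b) of the configuration, in polygon coordinates.  Then no polygon j … i with
  -- j < m ≤ i < n and q j < i is triangulated: its apex triangle either hides
  -- an ear t (t+2) in E, closes a short edge j (j+2), or leaves a smaller
  -- polygon of the same kind.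
  module PendantFan (m n : ℕ) (E : ℕ → ℕ → Set) (q : ℕ → ℕ)
    (attached : ∀ {j} → j < m → E j (q j))
    (attachment-≥ : ∀ {j} → j < m → m ≤ q j)
    (attachment-unique : ∀ {j t} → j < m → t < n → E j t → t ≡ q j)
    (attachment-step : ∀ {c c′} → c < c′ → c′ < m → q c′ ≤ suc (q c))
    (short-edge : ∀ {t} → m ≤ suc t → suc (suc t) < n → E t (suc (suc t)))
    (chord-absent : ∀ {a b} → (a , b) ∈ L → E a b → ⊥) where

    no-triangulation : ∀ {j i} → Triangulated j i → j < m → m ≤ i → i < n → q j < i → ⊥
    no-triangulation (edge j) j<m m≤i i<n qj<i =
      <-irrefl refl (<-≤-trans j<m (≤-trans (attachment-≥ j<m) (s≤s⁻¹ qj<i)))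
    no-triangulation {j} (triangle c j<c c<i jc ci tri-jc tri-ci) j<m m≤i i<n qj<i with m ≤? c
    ... | yes m≤c with m≤n⇒m<n∨m≡n c<i
    ...   | inj₁ c+1<i with ear tri-ci ci c+1<i
    ...     | t , c≤t , t+2≤i , tt+2∈ =
      chord-absent tt+2∈ (short-edge (≤-trans m≤c (≤-trans c≤t (n≤1+n t))) (≤-<-trans t+2≤i i<n))
    no-triangulation {j} (triangle c j<c c<i (inj₁ refl) ci tri-jc tri-ci) j<m m≤i i<n qj<i
      | yes m≤c | inj₂ refl =
      <-irrefl (≡-sym (attachment-unique j<m i<n (short-edge m≤c i<n))) qj<i
    no-triangulation {j} (triangle c j<c c<i (inj₂ jc∈) ci tri-jc tri-ci) j<m m≤i i<n qj<i
      | yes m≤c | inj₂ refl =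
      no-triangulation tri-jc j<m m≤c (<-trans c<i i<n)
        (≤∧≢⇒< (s≤s⁻¹ qj<i) (λ qj≡c → chord-absent jc∈ (subst (E j) qj≡c (attached j<m))))
    no-triangulation {j} (triangle c j<c c<i jc (inj₁ refl) tri-jc tri-ci) j<m m≤i i<n qj<i | no m≰c =
      <-irrefl refl (<-≤-trans qj<i (≤-trans (≰⇒> m≰c) (attachment-≥ j<m)))
    no-triangulation {j} (triangle c j<c c<i jc (inj₂ ci∈) tri-jc tri-ci) j<m m≤i i<n qj<i | no m≰c =
      no-triangulation tri-ci c<m m≤i i<n
        (≤∧≢⇒< (≤-trans (attachment-step j<c c<m) qj<i)
               (λ qc≡i → chord-absent ci∈ (subst (E c) qc≡i (attached c<m))))
      where
      c<m : c < m
      c<m = ≰⇒> m≰c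

sum-positive : ∀ {n} (h : Fin n → ℕ) (a : Fin n) → 1 ≤ h a → 1 ≤ sum (tabulate h)
sum-positive h Fin.zero    1≤ = ≤-trans 1≤ (m≤m+n _ _)
sum-positive h (Fin.suc a) 1≤ = ≤-trans (sum-positive (λ i → h (Fin.suc i)) a 1≤) (m≤n+m _ (h Fin.zero))

sum-two-positive : ∀ {n} (h : Fin n → ℕ) (a b : Fin n) → a ≢ b → 1 ≤ h a → 1 ≤ h b → 2 ≤ sum (tabulate h)
sum-two-positive h Fin.zero    Fin.zero    a≢b _   _   = ⊥-elim (a≢b refl)
sum-two-positive h Fin.zero    (Fin.suc b) _   1≤a 1≤b = +-mono-≤ 1≤a (sum-positive (λ i → h (Fin.suc i)) b 1≤b)
sum-two-positive h (Fin.suc a) Fin.zero    _   1≤a 1≤b = +-mono-≤ 1≤b (sum-positive (λ i → h (Fin.suc i)) a 1≤a)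
sum-two-positive h (Fin.suc a) (Fin.suc b) a≢b 1≤a 1≤b =
  ≤-trans (sum-two-positive (λ i → h (Fin.suc i)) a b (λ e → a≢b (cong Fin.suc e)) 1≤a 1≤b) (m≤n+m _ (h Fin.zero))

pendant-neighbour-unique : ∀ {n} (F : SimpleGraph n) {x a b} → deg F x ≡ 1 → Edge F x a → Edge F x b → a ≡ b
pendant-neighbour-unique {n} F {x} {a} {b} deg≡1 xa xb with a Fin.≟ b
... | yes a≡b = a≡b
... | no a≢b = ⊥-elim (<-irrefl refl (begin-strict
  1                                       <⟨ sum-two-positive h a b a≢b (positive xa) (positive xb) ⟩
  sum (tabulate h)                        ≡⟨ cong sum (map-tabulate (λ i → i) (λ u → b2n (adj F x u))) ⟨
  sum (map (λ u → b2n (adj F x u)) (tabulate (λ i → i)))  ≡⟨ deg≡1 ⟩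
  1                                       ∎))
  where
  open ≤-Reasoning
  h : Fin n → ℕ
  h u = b2n (adj F x u)
  positive : ∀ {u} → Edge F x u → 1 ≤ h u
  positive xu rewrite xu = ≤-refl

AllPairs-lookup : ∀ {A : Set} {R : A → A → Set} {xs : List A} → AllPairs R xs →
  ∀ {p q} → p ∈ xs → q ∈ xs → p ≡ q ⊎ R p q ⊎ R q p
AllPairs-lookup (_  ∷ _)   (here refl) (here refl) = inj₁ refl
AllPairs-lookup (Rx ∷ _)   (here refl) (there q∈) = inj₂ (inj₁ (All.lookup Rx q∈))
AllPairs-lookup (Rx ∷ _)   (there p∈) (here refl) = inj₂ (inj₂ (All.lookup Rx p∈))
AllPairs-lookup (_  ∷ Rxs) (there p∈) (there q∈) = AllPairs-lookup Rxs p∈ q∈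

true≢false : true ≢ false
true≢false ()

IsBoundary-sym : ∀ {n} .{{_ : NonZero n}} {x y : Fin n} → IsBoundary x y → IsBoundary y x
IsBoundary-sym (inj₁ p) = inj₂ p
IsBoundary-sym (inj₂ p) = inj₁ p

injective⇒surjective : ∀ {n} (f : Fin n → Fin n) → (∀ {i j} → f i ≡ f j → i ≡ j) → ∀ y → ∃[ i ] (f i ≡ y)
injective⇒surjective {suc n} f injective y with Fin.any? (λ i → f i Fin.≟ y)
... | yes hit = hit
... | no miss with Fin.pigeonhole (n<1+n n) (λ i → punchOut {i = y} {j = f i} (λ e → miss (i , ≡-sym e)))
...   | i , j , i<j , same =
  ⊥-elim (Fin.<-irrefl (injective (Fin.punchOut-injective {i = y} (λ e → miss (i , ≡-sym e))
                                                                  (λ e → miss (j , ≡-sym e)) same)) i<j)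

-- Reading the vertices of K_n through a boundary-following labelling w,
-- vertex x gets the position index x < n; a diagonal becomes the pair of the
-- positions of its endpoints, in increasing order.
module Coordinates (n : ℕ) .{{_ : NonZero n}} (w : ℕ → Fin n)
  (relabelling : Relabelling n (λ t → toℕ (w t)))
  (boundary : ∀ t → IsBoundary (w t) (w (suc t)))
  (periodic : w n ≡ w 0) where

  open Relabelling relabelling using (crossing)

  w-injective : ∀ {i j} → i < n → j < n → w i ≡ w j → i ≡ j
  w-injective i< j< e = Relabelling.injective relabelling i< j< (cong toℕ e)

  private
    onto : ∀ x → ∃[ i ] (w (toℕ i) ≡ x)
    onto = injective⇒surjective (λ i → w (toℕ i))
             (λ e → Fin.toℕ-injective (w-injective (Fin.toℕ<n _) (Fin.toℕ<n _) e))

  index : Fin n → ℕ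
  index x = toℕ (proj₁ (onto x))

  index< : ∀ x → index x < n
  index< x = Fin.toℕ<n (proj₁ (onto x))

  w-index : ∀ x → w (index x) ≡ x
  w-index x = proj₂ (onto x)

  w-crossing : ∀ {a c x y} → a < n → c < n → x < n → y < n → Crosses a c x y → Cross (w a) (w c) (w x) (w y)
  w-crossing a< c< x< y< cr = crosses⇒Cross (w _) (w _) (w _) (w _) (crossing a< c< x< y< cr)

  position : Fin n × Fin n → ℕ × ℕ
  position (x , y) with index x ≤? index y
  ... | yes _ = index x , index y
  ... | no _  = index y , index x

  Ends : Fin n × Fin n → ℕ × ℕ → Set
  Ends (x , y) (i , j) = i ≤ j × j < n × SamePair (w i) (w j) x y

  position-ends : ∀ p → Ends p (position p)
  position-ends (x , y) with index x ≤? index y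
  ... | yes ix≤iy = ix≤iy , index< y , inj₁ (w-index x , w-index y)
  ... | no ix≰iy  = <⇒≤ (≰⇒> ix≰iy) , index< x , inj₂ (w-index y , w-index x)

  ends-chord : ∀ {x y i j} → Ends (x , y) (i , j) → x ≢ y → ¬ IsBoundary x y → suc i < j
  ends-chord {x} {y} {i} {j} (i≤j , _ , same) x≢y not-boundary with m≤n⇒m<n∨m≡n i≤j
  ... | inj₂ refl = ⊥-elim (x≢y (from-same same))
    where
    from-same : SamePair (w i) (w i) x y → x ≡ y
    from-same (inj₁ (e₁ , e₂)) = trans (≡-sym e₁) e₂
    from-same (inj₂ (e₁ , e₂)) = trans (≡-sym e₂) e₁
  ... | inj₁ i<j with m≤n⇒m<n∨m≡n i<j
  ...   | inj₁ i+1<j = i+1<j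
  ...   | inj₂ refl  = ⊥-elim (not-boundary (transport same (boundary i)))
    where
    transport : SamePair (w i) (w (suc i)) x y → IsBoundary (w i) (w (suc i)) → IsBoundary x y
    transport (inj₁ (refl , refl)) b = b
    transport (inj₂ (refl , refl)) b = IsBoundary-sym b

  ends-not-base : ∀ {x y i j} → Ends (x , y) (i , j) → ¬ IsBoundary x y → ¬ (i ≡ 0 × j ≡ n ∸ 1)
  ends-not-base {x} {y} (_ , _ , same) not-boundary (refl , refl) = not-boundary (transport same last-edge)
    where
    last-edge : IsBoundary (w (n ∸ 1)) (w 0)
    last-edge = subst (IsBoundary (w (n ∸ 1))) (trans (cong w (suc-pred n)) periodic) (boundary (n ∸ 1))
    transport : SamePair (w 0) (w (n ∸ 1)) x y → IsBoundary (w (n ∸ 1)) (w 0) → IsBoundary x y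
    transport (inj₁ (refl , refl)) b = IsBoundary-sym b
    transport (inj₂ (refl , refl)) b = b

  module Diagonals (F : SimpleGraph n) (D : List (Fin n × Fin n)) (unique-D : Unique D)
    (diagonal : All (IsDiagonal F) D) (non-crossing : AllPairs NonCrossing D) where

    L : List (ℕ × ℕ)
    L = map position D

    member : ∀ {i j} → (i , j) ∈ L →
      ∃[ p ] (p ∈ D × IsDiagonal F p × position p ≡ (i , j) × Ends p (i , j))
    member ij∈ with ∈-map⁻ position ij∈
    ... | p , p∈ , refl = p , p∈ , All.lookup diagonal p∈ , refl , position-ends p

    L-chord : ∀ {i j} → (i , j) ∈ L → suc i < j
    L-chord ij∈ with member ij∈
    ... | _ , _ , (x<y , not-boundary , _) , _ , ends = ends-chord ends (λ e → <-irrefl (cong toℕ e) x<y) not-boundary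

    -- Diagonals are stored with toℕ x < toℕ y, so their positions determine them.
    ends-unique : ∀ {x y x′ y′ i j} → toℕ x < toℕ y → toℕ x′ < toℕ y′ →
      Ends (x , y) (i , j) → Ends (x′ , y′) (i , j) → (x , y) ≡ (x′ , y′)
    ends-unique _   _     (_ , _ , inj₁ (refl , refl)) (_ , _ , inj₁ (refl , refl)) = refl
    ends-unique _   _     (_ , _ , inj₂ (refl , refl)) (_ , _ , inj₂ (refl , refl)) = refl
    ends-unique x<y x′<y′ (_ , _ , inj₁ (refl , refl)) (_ , _ , inj₂ (refl , refl)) = ⊥-elim (<-asym x<y x′<y′)
    ends-unique x<y x′<y′ (_ , _ , inj₂ (refl , refl)) (_ , _ , inj₁ (refl , refl)) = ⊥-elim (<-asym x<y x′<y′)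

    L-unique : Unique L
    L-unique = distinct-positions unique-D diagonal
      where
      distinct-positions : ∀ {ps} → Unique ps → All (IsDiagonal F) ps → Unique (map position ps)
      distinct-positions []            []                 = []
      distinct-positions (p∉ ∷ unique) (p-diag ∷ diagonals) =
        All.map⁺ (All.zipWith (λ { (p≢q , q-diag) same → p≢q (ends-unique (proj₁ p-diag) (proj₁ q-diag)
                    (position-ends _) (subst (Ends _) (≡-sym same) (position-ends _))) }) (p∉ , diagonals))
        ∷ distinct-positions unique diagonals

    L-non-interleaving : ∀ {a x c y} → (a , c) ∈ L → (x , y) ∈ L → a < x → x < c → c < y → ⊥
    L-non-interleaving {a} {x} {c} {y} ac∈ xy∈ a<x x<c c<y with member ac∈ | member xy∈
    ... | (p₁ , p₂) , p∈ , _ , at-ac , (_ , c< , same-p) | (q₁ , q₂) , q∈ , _ , at-xy , (_ , y< , same-q) =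
      excluded (AllPairs-lookup non-crossing p∈ q∈)
      where
      x< : x < n
      x< = <-trans x<c (<-trans c<y y<)
      a< : a < n
      a< = <-trans a<x x<
      p-cross-q : Cross p₁ p₂ q₁ q₂
      p-cross-q = Cross-SamePair same-p same-q (w-crossing a< c< x< y< (proj₁ (interleaved-crosses a<x x<c c<y)))
      q-cross-p : Cross q₁ q₂ p₁ p₂
      q-cross-p = Cross-SamePair same-q same-p (w-crossing x< y< a< c< (proj₂ (interleaved-crosses a<x x<c c<y)))
      excluded : (p₁ , p₂) ≡ (q₁ , q₂) ⊎ NonCrossing (p₁ , p₂) (q₁ , q₂) ⊎ NonCrossing (q₁ , q₂) (p₁ , p₂) →
                 ⊥
      excluded (inj₁ refl)       = <-irrefl (cong proj₁ (trans (≡-sym at-ac) at-xy)) a<x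
      excluded (inj₂ (inj₁ p∦q)) = p∦q p-cross-q
      excluded (inj₂ (inj₂ q∦p)) = q∦p q-cross-p

    L-not-edge : ∀ {i j} → (i , j) ∈ L → Edge F (w i) (w j) → ⊥
    L-not-edge {i} {j} ij∈ ij-edge with member ij∈
    ... | _ , _ , (_ , _ , xy-absent) , _ , (_ , _ , inj₁ (refl , refl)) =
      true≢false (trans (≡-sym ij-edge) xy-absent)
    ... | _ , _ , (_ , _ , xy-absent) , _ , (_ , _ , inj₂ (refl , refl)) =
      true≢false (trans (≡-sym ij-edge) (trans (SimpleGraph.sym F (w i) (w j)) xy-absent))

    L-within : ∀ {i j} → (i , j) ∈ L → j ≤ n ∸ 1 × ¬ (i ≡ 0 × j ≡ n ∸ 1)
    L-within ij∈ with member ij∈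
    ... | _ , _ , (_ , not-boundary , _) , _ , ends@(_ , j< , _) =
      ≤-pred (subst (_ ≤_) (≡-sym (suc-pred n)) j<) , ends-not-base ends not-boundary

    open ChordFamily L L-unique L-chord L-non-interleaving public

    triangulated : 3 ≤ n → length D ≡ n ∸ 3 → Triangulated 0 (n ∸ 1)
    triangulated 3≤n length-D = polygon-triangulated n 3≤n (trans (length-map position D) length-D) L-within

module LabelledTriangulation (n : ℕ) .{{_ : NonZero n}} (F : SimpleGraph n) (s : Fin n) (o : Bool) (R : ℕ)
  (D : List (Fin n × Fin n)) (unique-D : Unique D) (diagonal : All (IsDiagonal F) D)
  (non-crossing : AllPairs NonCrossing D) where

  open LabellingFacts n s

  v : ℕ → Fin n
  v = Labelling s o

  v-periodic : ∀ r → v (n + r) ≡ v r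
  v-periodic = labelling-periodic o

  w : ℕ → Fin n
  w t = v (R + t)

  w-boundary : ∀ t → IsBoundary (w t) (w (suc t))
  w-boundary t = subst (λ r → IsBoundary (w t) (v r)) (≡-sym (+-suc R t)) (labelling-boundary o (R + t))

  w-periodic : w n ≡ w 0
  w-periodic = trans (cong v (+-comm R n)) (trans (v-periodic R) (cong v (≡-sym (+-identityʳ R))))

  open Coordinates n w (labelling-relabelling o R) w-boundary w-periodic public
  open Diagonals F D unique-D diagonal non-crossing public

-- Case (a): let v_c be the apex of the triangle on the boundary edge
-- v_0 v_{n-1}.  Its side v_0 v_c is a diagonal with 2 ≤ c ≤ n-2, or c = 1 and
-- its side v_1 v_{n-1} is a diagonal; either way that diagonal is an edge of F.
case-a : ∀ n′ (F : SimpleGraph (4 + n′)) s o → CaseA F (Labelling s o) → ¬ ComplementAdmitsTriangulation F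
case-a n′ F s o star (_ , D , length-D , unique-D , diagonal , non-crossing) =
  no-apex (triangulated (s≤s (s≤s (s≤s z≤n))) length-D) refl
  where
  n : ℕ
  n = 4 + n′
  open LabelledTriangulation n F s o 0 D unique-D diagonal non-crossing

  fan-edge : ∀ {c} → 2 ≤ c → c ≤ n ∸ 2 → Edge F (w 0) (w c)
  fan-edge {c} 2≤c c≤ = Equivalence.from (star (w 0) (w c)) (inj₁ (c , 2≤c , c≤ , inj₁ (refl , refl)))

  cross-edge : Edge F (w 1) (w (n ∸ 1))
  cross-edge = Equivalence.from (star (w 1) (w (n ∸ 1))) (inj₂ (inj₁ (refl , refl)))

  no-apex : ∀ {b} → Triangulated 0 b → b ≡ n ∸ 1 → ⊥
  no-apex (edge 0) ()
  no-apex (triangle _ _ _ (inj₁ refl) (inj₁ refl) _ _) ()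
  no-apex (triangle _ _ _ (inj₁ refl) (inj₂ 1b∈) _ _) refl = L-not-edge 1b∈ cross-edge
  no-apex (triangle c _ c<b (inj₂ 0c∈) _ _ _) refl = L-not-edge 0c∈ (fan-edge (L-chord 0c∈) (s≤s⁻¹ c<b))

-- Case (b), with k = k₁ + 1 inner vertices v_0 … v_{k-1} and m = d + 4
-- pendant vertices v_k … v_{n-1}.  Read from v_k on, the pendant vertices are
-- the positions 0 … m-1; conditions (i)–(iii) give exactly the hypotheses of
-- PendantFan, and the whole polygon 0 … n-1 is a polygon of the excluded kind
-- since v_k is joined to v_{k-2}, at position n - 2.
module CaseBContradiction (k₁ d : ℕ) where
  k m n : ℕ
  k = suc k₁
  m = 4 + d
  n = 4 + (k + d)

  module _ (F : SimpleGraph n) (s : Fin n) (o : Bool)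
    (inner : ∀ i → i < k → 2 ≤ deg F (Labelling s o i) × Edge F (Labelling s o (i + (n ∸ 1))) (Labelling s o (i + 1)))
    (pendant : ∀ i → k ≤ i → i ≤ n ∸ 1 →
      deg F (Labelling s o i) ≡ 1 × ∃[ u ] (Edge F (Labelling s o i) u × ¬ deg F u ≡ 1))
    (crossing : ∀ (u u′ : Fin n) (i j : ℕ) → i < n → j < n → deg F u ≡ 1 → deg F u′ ≡ 1 →
      Edge F u (Labelling s o i) → Edge F u′ (Labelling s o j) → Cross u (Labelling s o i) u′ (Labelling s o j) →
      j ≡ suc i ⊎ i ≡ suc j)
    where

    module _ (D : List (Fin n × Fin n)) (unique-D : Unique D) (diagonal : All (IsDiagonal F) D)
      (non-crossing : AllPairs NonCrossing D) where

      open LabelledTriangulation n F s o k D unique-D diagonal non-crossing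

      E : ℕ → ℕ → Set
      E a b = Edge F (w a) (w b)

      pendant-at : ∀ {j} → j < m → deg F (w j) ≡ 1 × ∃[ u ] (Edge F (w j) u × ¬ deg F u ≡ 1)
      pendant-at {j} (s≤s j≤3+d) =
        pendant (k + j) (m≤m+n k j) (≤-trans (+-monoʳ-≤ k j≤3+d) (≤-reflexive (shuffle k d)))
        where
        shuffle : ∀ k d → k + (3 + d) ≡ 3 + (k + d)
        shuffle = solve-∀

      attachment : ℕ → ℕ
      attachment j with j <? m
      ... | yes j<m = index (proj₁ (proj₂ (pendant-at j<m)))
      ... | no _    = 0

      attachment-spec : ∀ {j} → j < m → E j (attachment j) × m ≤ attachment j × attachment j < n ×
        (∀ {t} → t < n → E j t → t ≡ attachment j)
      attachment-spec {j} j<m with j <? m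
      ... | no j≮m = ⊥-elim (j≮m j<m)
      ... | yes j<m′ with pendant-at j<m′
      ...   | deg≡1 , u , ju , u-not-pendant = j-u , m≤u , index< u , unique
        where
        j-u : E j (index u)
        j-u = subst (λ z → Edge F (w j) z) (≡-sym (w-index u)) ju
        m≤u : m ≤ index u
        m≤u = ≮⇒≥ (λ u<m → u-not-pendant (subst (λ z → deg F z ≡ 1) (w-index u) (proj₁ (pendant-at u<m))))
        unique : ∀ {t} → t < n → E j t → t ≡ index u
        unique t< jt = w-injective t< (index< u) (trans (pendant-neighbour-unique F deg≡1 jt ju) (≡-sym (w-index u)))

      attached : ∀ {j} → j < m → E j (attachment j)
      attached j<m = proj₁ (attachment-spec j<m)

      attachment-≥ : ∀ {j} → j < m → m ≤ attachment j
      attachment-≥ j<m = proj₁ (proj₂ (attachment-spec j<m))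

      attachment-< : ∀ {j} → j < m → attachment j < n
      attachment-< j<m = proj₁ (proj₂ (proj₂ (attachment-spec j<m)))

      attachment-unique : ∀ {j t} → j < m → t < n → E j t → t ≡ attachment j
      attachment-unique j<m = proj₂ (proj₂ (proj₂ (attachment-spec j<m)))

      v-position : ∀ {y} → m ≤ y → y < n → ∃[ e ] (y ≡ m + e × e < n × w y ≡ v e)
      v-position {y} m≤y y< with m≤n⇒∃[o]m+o≡n m≤y
      ... | e , refl = e , refl , ≤-<-trans (m≤n+m e m) y< , trans (cong v (shuffle k₁ d e)) (v-periodic e)
        where
        shuffle : ∀ k₁ d e → suc k₁ + (4 + d + e) ≡ 4 + (suc k₁ + d) + e
        shuffle = solve-∀

      -- Condition (i) for v_{i}, i < k, is the short edge at position t = m - 1 + i.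
      short-edge : ∀ {t} → m ≤ suc t → suc (suc t) < n → E t (suc (suc t))
      short-edge {t} m≤t+1 t+2<n with m≤n⇒∃[o]m+o≡n m≤t+1
      ... | i , refl = subst₂ (Edge F) (cong v (shuffle₁ k d i)) (trans (≡-sym (v-periodic (i + 1))) (cong v (shuffle₂ k d i)))
                         (proj₂ (inner i i<k))
        where
        shuffle₁ : ∀ k d i → i + (3 + (k + d)) ≡ k + (3 + (d + i))
        shuffle₁ = solve-∀
        shuffle₂ : ∀ k d i → 4 + (k + d) + (i + 1) ≡ k + (5 + (d + i))
        shuffle₂ = solve-∀
        shuffle₃ : ∀ d i → suc i + d ≡ suc (d + i)
        shuffle₃ = solve-∀
        i<k : i < k
        i<k = +-cancelʳ-≤ d (suc i) k (≤-trans (≤-reflexive (shuffle₃ d i))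
                (≤-trans (n≤1+n _) (s≤s⁻¹ (s≤s⁻¹ (s≤s⁻¹ (s≤s⁻¹ t+2<n))))))

      m<n : m < n
      m<n = s≤s (s≤s (s≤s (s≤s (s≤s (m≤n+m d k₁)))))

      -- Condition (iii): the pendant edges at positions c < c′ cross unless
      -- c′ attaches at most one step beyond c.
      attachment-step : ∀ {c c′} → c < c′ → c′ < m → attachment c′ ≤ suc (attachment c)
      attachment-step {c} {c′} c<c′ c′<m with attachment c′ ≤? suc (attachment c)
      ... | yes q′≤ = q′≤
      ... | no q′≰ = ⊥-elim (separated (v-position (attachment-≥ c<m) (attachment-< c<m))
                                       (v-position (attachment-≥ c′<m) (attachment-< c′<m)))
        where
        c<m : c < m
        c<m = <-trans c<c′ c′<m
        q+1<q′ : suc (attachment c) < attachment c′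
        q+1<q′ = ≰⇒> q′≰
        separated : ∃[ e ] (attachment c ≡ m + e × e < n × w (attachment c) ≡ v e) →
                    ∃[ e′ ] (attachment c′ ≡ m + e′ × e′ < n × w (attachment c′) ≡ v e′) → ⊥
        separated (e , q≡ , e< , w-q) (e′ , q′≡ , e′< , w-q′) =
          neither (crossing (w c) (w c′) e e′ e< e′< (proj₁ (pendant-at c<m)) (proj₁ (pendant-at c′<m))
                    (subst (Edge F (w c)) w-q (attached c<m)) (subst (Edge F (w c′)) w-q′ (attached c′<m))
                    (subst₂ (λ x y → Cross (w c) x (w c′) y) w-q w-q′
                      (w-crossing (<-trans c<m m<n) (attachment-< c<m) (<-trans c′<m m<n) (attachment-< c′<m)
                        (proj₁ (interleaved-crosses c<c′ (<-≤-trans c′<m (attachment-≥ c<m)) (<-trans (n<1+n _) q+1<q′))))))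
          where
          neither : e′ ≡ suc e ⊎ e ≡ suc e′ → ⊥
          neither (inj₁ refl) = <-irrefl (≡-sym (trans q′≡ (trans (+-suc m e) (cong suc (≡-sym q≡))))) q+1<q′
          neither (inj₂ refl) = <-asym (<-trans (n<1+n _) q+1<q′)
            (subst (attachment c′ <_) (≡-sym (trans q≡ (trans (+-suc m e′) (cong suc (≡-sym q′≡))))) (n<1+n _))

      -- Condition (i) for v_{k-1}: v_k (position 0) is joined to v_{k-2} (position n - 2).
      first-attachment : attachment 0 ≡ n ∸ 2
      first-attachment = ≡-sym (attachment-unique (s≤s z≤n) (n≤1+n _)
        (trans (SimpleGraph.sym F (w 0) (w (n ∸ 2)))
               (subst₂ (Edge F) (cong v (shuffle₁ k₁ d)) (cong v (shuffle₂ k₁)) (proj₂ (inner k₁ ≤-refl)))))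
        where
        shuffle₁ : ∀ k₁ d → k₁ + (3 + (suc k₁ + d)) ≡ suc k₁ + (2 + (suc k₁ + d))
        shuffle₁ = solve-∀
        shuffle₂ : ∀ k₁ → k₁ + 1 ≡ suc k₁ + 0
        shuffle₂ = solve-∀

      open PendantFan m n E attachment attached attachment-≥ attachment-unique attachment-step short-edge L-not-edge

      contradiction : length D ≡ n ∸ 3 → ⊥
      contradiction length-D =
        no-triangulation (triangulated (s≤s (s≤s (s≤s z≤n))) length-D) (s≤s z≤n) (s≤s⁻¹ m<n) ≤-refl
          (subst (_< n ∸ 1) (≡-sym first-attachment) ≤-refl)

    case-b : ¬ ComplementAdmitsTriangulation F
    case-b (_ , D , length-D , unique-D , diagonal , non-crossing) =
      contradiction D unique-D diagonal non-crossing length-D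

proposition1 : (n : ℕ) .{{_ : NonZero n}} → 4 ≤ n → (F : SimpleGraph n) →
    ConfigStar F → ¬ ComplementAdmitsTriangulation F
proposition1 (suc (suc (suc (suc n′)))) (s≤s (s≤s (s≤s (s≤s _)))) F (_ , _ , s , o , inj₁ star) = case-a n′ F s o star
proposition1 (suc (suc (suc (suc n′)))) (s≤s (s≤s (s≤s (s≤s _)))) F (_ , _ , s , o , inj₂ (suc k₁ , s≤s _ , k≤n′ , inner , pendant , crossing))
  with m≤n⇒∃[o]m+o≡n k≤n′
... | d , refl = CaseBContradiction.case-b k₁ d F s o inner pendant crossing
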